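{- Let $H$ be a $k$-uniform hypergraph on $n$ vertices. Then $e(H) \leq d_1(H)^{k-1}n$.
   Context: The skeletal degeneracy $d_1(H)$ is the degeneracy of the $1$-skeleton of $H$ (the graph on $V(H)$ joining two vertices iff they lie in a common edge of $H$), i.e. the least $d$ such that every subgraph of that graph has minimum degree at most $d$. $e(H)$ is the number of edges of $H$. -}

module Defs where

open import Data.Nat using (ℕ; _≤_)
open import Data.Bool using (Bool; true; false; _∧_; not)
open import Data.Fin using (Fin; _≟_)
open import Data.Fin.Subset using (Subset; ∣_∣; Nonempty)
open import Data.Vec using (lookup; tabulate)
open import Data.List using (List; length)
open import Data.Bool.ListAction using (any)
open import Data.List.Relation.Unary.All using (All)
open import Data.List.Relation.Unary.Unique.Propositional using (Unique)
open import Data.Product using (Σ; _×_)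
open import Relation.Nullary.Decidable using (⌊_⌋)
open import Relation.Binary.PropositionalEquality using (_≡_)

record Hypergraph (n k : ℕ) : Set where
  field
    edges   : List (Subset n)
    uniform : All (λ e → ∣ e ∣ ≡ k) edges
    simple  : Unique edges
open Hypergraph public

e : ∀ {n k} → Hypergraph n k → ℕ
e H = length (edges H)

adj : ∀ {n k} → Hypergraph n k → Fin n → Fin n → Bool
adj H u v = not ⌊ u ≟ v ⌋ ∧ any (λ f → lookup f u ∧ lookup f v) (edges H)

degIn : ∀ {n k} → Hypergraph n k → Subset n → Fin n → ℕ
degIn H S v = ∣ tabulate (λ u → lookup S u ∧ adj H u v) ∣

-- every (nonempty, induced) subgraph of the 1-skeleton has a vertex of degree ≤ d
-- (restricting to induced subgraphs is harmless: a subgraph's minimum degree is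
--  at most that of the induced subgraph on the same vertex set)
SkelDegenerate : ∀ {n k} → Hypergraph n k → ℕ → Set
SkelDegenerate {n} H d =
  (S : Subset n) → Nonempty S →
  Σ (Fin n) λ v → (lookup S v ≡ true) × (degIn H S v ≤ d)

IsSkeletalDegeneracy : ∀ {n k} → Hypergraph n k → ℕ → Set
IsSkeletalDegeneracy H d =
  SkelDegenerate H d × (∀ d' → SkelDegenerate H d' → d ≤ d')

-- Edges inside a vertex set S are counted by induction on S. Degeneracy gives
-- v ∈ S with at most d skeleton neighbours in S. Deleting v from the edges
-- inside S through v yields distinct (k-1)-subsets of these neighbours, so
-- there are at most d^(k-1) of them; the remaining edges lie inside S - v.
-- Hence S contains at most d^(k-1)·|S| edges. The bound |T|^m on the number of
-- distinct m-subsets of T comes from the same split at a vertex x ∈ T, using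
-- |T-x|^(m-1) + |T-x|^m ≤ |T|^m.
module Submission where

open import Defs
open import Data.Nat using (ℕ; zero; suc; _≤_; _<_; _+_; _*_; _^_; _∸_; z≤n; s≤s)
open import Data.Nat.Properties
  using (≤-trans; ≤-reflexive; ≤-refl; +-suc; *-suc; n≮0; n≤0⇒n≡0; 0≢1+n; suc-injective;
         n≤1+n; +-mono-≤; *-monoʳ-≤; ^-monoˡ-≤; module ≤-Reasoning)
open import Data.Bool using (true; _∧_)
import Data.Bool as Bool
open import Data.Bool.Properties using (T-≡; T-∧)
open import Data.Fin using (Fin; _≟_)
import Data.Fin as Fin
open import Data.Fin.Subset
open import Data.Fin.Subset.Properties
open import Data.Fin.Subset.Induction using (⊂-wellFounded; Acc; acc)
open import Data.Vec using (_∷_; here; there; lookup; tabulate)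
open import Data.Vec.Properties using (lookup∘tabulate; []=⇒lookup; lookup⇒[]=)
open import Data.List using (List; []; _∷_; length; map; filter)
open import Data.List.Properties using (filter-≐; filter-all; filter-none; length-map; length-filter)
open import Data.List.Membership.Propositional using (lose) renaming (_∈_ to _∈ₗ_)
open import Data.List.Membership.Propositional.Properties using (∈-filter⁻)
open import Data.List.Relation.Unary.All as All using (All; []; _∷_)
import Data.List.Relation.Unary.All.Properties as All
import Data.List.Relation.Unary.Any as Any
open import Data.List.Relation.Unary.Any.Properties using (any⁺)
open import Data.List.Relation.Unary.Unique.Propositional using (Unique; []; _∷_)
import Data.List.Relation.Unary.Unique.Propositional.Properties as Unique
open import Data.Product using (_×_; _,_; proj₂)
open import Function using (_∘_; _⇔_; mk⇔; Equivalence)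
open import Level using (Level)
open import Relation.Nullary using (¬_; yes; no; contradiction)
open import Relation.Unary using (Pred; Decidable)
open import Relation.Unary.Properties using (∁?; _∩?_)
open import Relation.Binary.PropositionalEquality

private
  variable
    a b ℓ ℓ₁ ℓ₂ : Level
    A : Set a
    B : Set b
    m n : ℕ
    x y : Fin n
    p q S T : Subset n
    L : List (Subset n)

module _ {P : Pred A ℓ₁} {Q : Pred A ℓ₂} (P? : Decidable P) (Q? : Decidable Q) where

  filter-filter : ∀ xs → filter Q? (filter P? xs) ≡ filter (P? ∩? Q?) xs
  filter-filter [] = refl
  filter-filter (x ∷ xs) with P? x
  ... | no  _ = filter-filter xs
  ... | yes _ with Q? x
  ...   | yes _ = cong (x ∷_) (filter-filter xs)
  ...   | no  _ = filter-filter xs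

module _ {P : Pred A ℓ} (P? : Decidable P) where

  length-filter+length-filter-∁ : ∀ xs →
    length (filter P? xs) + length (filter (∁? P?) xs) ≡ length xs
  length-filter+length-filter-∁ [] = refl
  length-filter+length-filter-∁ (x ∷ xs) with P? x
  ... | yes _ = cong suc (length-filter+length-filter-∁ xs)
  ... | no  _ = trans (+-suc _ _) (cong suc (length-filter+length-filter-∁ xs))

map-injectiveOn⁺ : ∀ {f : A → B} {xs} →
  (∀ {x y} → x ∈ₗ xs → y ∈ₗ xs → f x ≡ f y → x ≡ y) → Unique xs → Unique (map f xs)
map-injectiveOn⁺ inj [] = []
map-injectiveOn⁺ inj (x∉xs ∷ u) =
  All.map⁺ (All.tabulate λ y∈xs fx≡fy →
    All.lookup x∉xs y∈xs (inj (Any.here refl) (Any.there y∈xs) fx≡fy))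
  ∷ map-injectiveOn⁺ (λ x∈ y∈ → inj (Any.there x∈) (Any.there y∈)) u

Unique∧All≡⇒length≤1 : ∀ {x : A} {xs} → Unique xs → All (_≡ x) xs → length xs ≤ 1
Unique∧All≡⇒length≤1 []            []               = z≤n
Unique∧All≡⇒length≤1 (_ ∷ [])      (_ ∷ [])         = ≤-refl
Unique∧All≡⇒length≤1 ((y≢z ∷ _) ∷ _) (refl ∷ refl ∷ _) = contradiction refl y≢z

m^n+m^[1+n]≤[1+m]^[1+n] : ∀ m n → m ^ n + m ^ suc n ≤ suc m ^ suc n
m^n+m^[1+n]≤[1+m]^[1+n] m n = *-monoʳ-≤ (suc m) (^-monoˡ-≤ n (n≤1+n m))

x∉p-x : x ∉ p - x
x∉p-x {x = Fin.zero}  {_ ∷ p} ()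
x∉p-x {x = Fin.suc x} {_ ∷ p} (there x∈p-x) = x∉p-x x∈p-x

x∈p-y⇒x≢y : x ∈ p - y → x ≢ y
x∈p-y⇒x≢y x∈p-x refl = x∉p-x x∈p-x

∣p∣≡1+∣p-x∣ : x ∈ p → ∣ p ∣ ≡ suc ∣ p - x ∣
∣p∣≡1+∣p-x∣ {x = Fin.zero}  {inside ∷ p}  here          = cong suc (sym (cong ∣_∣ (p─⊥≡p p)))
∣p∣≡1+∣p-x∣ {x = Fin.suc x} {inside ∷ p}  (there x∈p) = cong suc (∣p∣≡1+∣p-x∣ x∈p)
∣p∣≡1+∣p-x∣ {x = Fin.suc x} {outside ∷ p} (there x∈p) = ∣p∣≡1+∣p-x∣ x∈p

∣p∣≡0⇒p≡⊥ : ∣ p ∣ ≡ 0 → p ≡ ⊥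
∣p∣≡0⇒p≡⊥ {p = p} ∣p∣≡0 =
  Empty-unique λ (x , x∈p) → n≮0 (subst (∣ p - x ∣ <_) ∣p∣≡0 (x∈p⇒∣p-x∣<∣p∣ x∈p))

Empty∧p⊆q⇒∣p∣≡0 : ∀ {n} {p q : Subset n} → Empty q → p ⊆ q → ∣ p ∣ ≡ 0
Empty∧p⊆q⇒∣p∣≡0 {n} ∅ p⊆q =
  n≤0⇒n≡0 (subst (_ ≤_) (trans (cong ∣_∣ (Empty-unique ∅)) (∣⊥∣≡0 n)) (p⊆q⇒∣p∣≤∣q∣ p⊆q))

p⊆q-x⇔p⊆q∧x∉p : p ⊆ q - x ⇔ (p ⊆ q × x ∉ p)
p⊆q-x⇔p⊆q∧x∉p {q = q} {x} = mk⇔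
  (λ p⊆q-x → (λ {y} y∈p → p─q⊆p q ⁅ x ⁆ (p⊆q-x y∈p)) , λ x∈p → x∉p-x (p⊆q-x x∈p))
  (λ (p⊆q , x∉p) {y} y∈p → x∈p∧x≢y⇒x∈p-y (p⊆q y∈p) λ { refl → x∉p y∈p })

p⊆q⇒p-x⊆q-x : p ⊆ q → p - x ⊆ q - x
p⊆q⇒p-x⊆q-x {p = p} {x = x} p⊆q =
  Equivalence.from p⊆q-x⇔p⊆q∧x∉p ((λ {y} y∈p-x → p⊆q (p─q⊆p p ⁅ x ⁆ y∈p-x)) , x∉p-x)

-x-injectiveOn : x ∈ p → x ∈ q → p - x ≡ q - x → p ≡ q
-x-injectiveOn x∈p x∈q eq = ⊆-antisym (⊆-from x∈q eq) (⊆-from x∈p (sym eq))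
  where
  ⊆-from : x ∈ q → p - x ≡ q - x → p ⊆ q
  ⊆-from {x = x} {q = q} x∈q eq {y} y∈p with y ≟ x
  ... | yes refl = x∈q
  ... | no  y≢x  = p─q⊆p q ⁅ x ⁆ (subst (y ∈_) eq (x∈p∧x≢y⇒x∈p-y y∈p y≢x))

within : Subset n → List (Subset n) → List (Subset n)
within S = filter (_⊆? S)

link : Fin n → List (Subset n) → List (Subset n)
link x L = map (_- x) (filter (x ∈?_) L)

within-all : All (_⊆ S) L → within S L ≡ L
within-all {S = S} = filter-all (_⊆? S)

within-Empty : Empty S → All (λ g → ∣ g ∣ ≡ suc m) L → within S L ≡ []
within-Empty {S = S} {m = m} ∅ = filter-none (_⊆? S) ∘ All.map ⊈S
  where
  ⊈S : ∀ {g} → ∣ g ∣ ≡ suc m → ¬ g ⊆ S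
  ⊈S ∣g∣≡1+m g⊆S = 0≢1+n (trans (sym (Empty∧p⊆q⇒∣p∣≡0 ∅ g⊆S)) ∣g∣≡1+m)

length-within-split : ∀ x (S : Subset n) L →
  length (within S L) ≡ length (link x (within S L)) + length (within (S - x) L)
length-within-split x S L = begin
  length (within S L)
    ≡⟨ length-filter+length-filter-∁ (x ∈?_) (within S L) ⟨
  length (filter (x ∈?_) (within S L)) + length (filter (∁? (x ∈?_)) (within S L))
    ≡⟨ cong₂ _+_ (sym (length-map (_- x) (filter (x ∈?_) (within S L)))) (cong length without-x) ⟩
  length (link x (within S L)) + length (within (S - x) L)
    ∎
  where
  open ≡-Reasoning
  without-x : filter (∁? (x ∈?_)) (within S L) ≡ within (S - x) L
  without-x = trans (filter-filter (_⊆? S) (∁? (x ∈?_)) L)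
    (filter-≐ _ (_⊆? S - x) (Equivalence.from p⊆q-x⇔p⊆q∧x∉p , Equivalence.to p⊆q-x⇔p⊆q∧x∉p) L)

All-link : ∀ {P : Pred (Subset n) ℓ} → (∀ {g} → g ∈ₗ L → x ∈ g → P (g - x)) → All P (link x L)
All-link {L = L} {x = x} h =
  All.map⁺ (All.tabulate λ g∈ → let g∈L , x∈g = ∈-filter⁻ (x ∈?_) {xs = L} g∈ in h g∈L x∈g)

link-unique : Unique L → Unique (link x L)
link-unique {L = L} {x = x} u =
  map-injectiveOn⁺ (λ g∈ h∈ → -x-injectiveOn (x∈ g∈) (x∈ h∈)) (Unique.filter⁺ (x ∈?_) u)
  where
  x∈ : ∀ {g} → g ∈ₗ filter (x ∈?_) L → x ∈ g
  x∈ = proj₂ ∘ ∈-filter⁻ (x ∈?_) {xs = L}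

link-size : All (λ g → ∣ g ∣ ≡ suc m) L → All (λ g → ∣ g ∣ ≡ m) (link x L)
link-size sz = All-link λ g∈L x∈g → suc-injective (trans (sym (∣p∣≡1+∣p-x∣ x∈g)) (All.lookup sz g∈L))

length-within≤∣T∣^m : ∀ m (T : Subset n) {L} → Unique L → All (λ g → ∣ g ∣ ≡ m) L →
  length (within T L) ≤ ∣ T ∣ ^ m
length-within≤∣T∣^m m T = go m T (⊂-wellFounded T)
  where
  go : ∀ m (T : Subset n) → Acc _⊂_ T → ∀ {L} → Unique L → All (λ g → ∣ g ∣ ≡ m) L →
    length (within T L) ≤ ∣ T ∣ ^ m
  go zero T _ {L} u sz =
    ≤-trans (length-filter (_⊆? T) L) (Unique∧All≡⇒length≤1 u (All.map ∣p∣≡0⇒p≡⊥ sz))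
  go (suc m) T (acc rec) {L} u sz with nonempty? T
  ... | no ∅ = ≤-trans (≤-reflexive (cong length (within-Empty ∅ sz))) z≤n
  ... | yes (x , x∈T) = begin
    length (within T L)
      ≡⟨ length-within-split x T L ⟩
    length (link x (within T L)) + length (within (T - x) L)
      ≡⟨ cong (λ l → length l + length (within (T - x) L)) (within-all link⊆T-x) ⟨
    length (within (T - x) (link x (within T L))) + length (within (T - x) L)
      ≤⟨ +-mono-≤
           (go m (T - x) (rec T-x⊂T)
             (link-unique (Unique.filter⁺ (_⊆? T) u)) (link-size (All.filter⁺ (_⊆? T) sz)))
           (go (suc m) (T - x) (rec T-x⊂T) u sz) ⟩
    ∣ T - x ∣ ^ m + ∣ T - x ∣ ^ suc m
      ≤⟨ m^n+m^[1+n]≤[1+m]^[1+n] ∣ T - x ∣ m ⟩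
    suc ∣ T - x ∣ ^ suc m
      ≤⟨ ^-monoˡ-≤ (suc m) (x∈p⇒∣p-x∣<∣p∣ x∈T) ⟩
    ∣ T ∣ ^ suc m
      ∎
    where
    open ≤-Reasoning
    T-x⊂T : T - x ⊂ T
    T-x⊂T = x∈p⇒p-x⊂p x∈T
    link⊆T-x : All (_⊆ T - x) (link x (within T L))
    link⊆T-x = All-link λ g∈ _ → p⊆q⇒p-x⊆q-x (proj₂ (∈-filter⁻ (_⊆? T) {xs = L} g∈))

length≤∣T∣^m : Unique L → All (λ g → ∣ g ∣ ≡ m) L → All (_⊆ T) L → length L ≤ ∣ T ∣ ^ m
length≤∣T∣^m {L = L} {m = m} {T = T} u sz ⊆T =
  subst (λ l → length l ≤ ∣ T ∣ ^ m) (within-all ⊆T) (length-within≤∣T∣^m m T u sz)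

module _ {n k} (H : Hypergraph n k) where

  neighboursIn : Subset n → Fin n → Subset n
  neighboursIn S v = tabulate λ u → lookup S u ∧ adj H u v

  ∈-edge⇒adj : ∀ {u v f} → u ≢ v → f ∈ₗ edges H → u ∈ f → v ∈ f → adj H u v ≡ true
  ∈-edge⇒adj {u} {v} u≢v f∈E u∈f v∈f with u ≟ v
  ... | yes u≡v = contradiction u≡v u≢v
  ... | no  _   =
    Equivalence.to T-≡ (any⁺ _ (lose f∈E (Equivalence.from T-∧ (T[∈] u∈f , T[∈] v∈f))))
    where
    T[∈] : ∀ {x : Fin n} {p} → x ∈ p → Bool.T (lookup p x)
    T[∈] = Equivalence.from T-≡ ∘ []=⇒lookup

  ∈-neighboursIn : ∀ {S u v f} →
    u ∈ S → u ≢ v → f ∈ₗ edges H → u ∈ f → v ∈ f → u ∈ neighboursIn S v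
  ∈-neighboursIn {S} {u} {v} u∈S u≢v f∈E u∈f v∈f = lookup⇒[]= u _ (begin
    lookup (neighboursIn S v) u ≡⟨ lookup∘tabulate _ u ⟩
    lookup S u ∧ adj H u v      ≡⟨ cong₂ _∧_ ([]=⇒lookup u∈S) (∈-edge⇒adj u≢v f∈E u∈f v∈f) ⟩
    true                        ∎)
    where open ≡-Reasoning

module _ {n k} (H : Hypergraph n (suc k)) {d} (degenerate : SkelDegenerate H d) where

  length-within-edges≤ : ∀ S → length (within S (edges H)) ≤ d ^ k * ∣ S ∣
  length-within-edges≤ S = go S (⊂-wellFounded S)
    where
    E = edges H
    go : ∀ S → Acc _⊂_ S → length (within S E) ≤ d ^ k * ∣ S ∣
    go S (acc rec) with nonempty? S
    ... | no ∅ = ≤-trans (≤-reflexive (cong length (within-Empty ∅ (uniform H)))) z≤n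
    ... | yes S≢∅ with degenerate S S≢∅
    ...   | v , S[v]≡true , deg = begin
      length (within S E)
        ≡⟨ length-within-split v S E ⟩
      length (link v (within S E)) + length (within (S - v) E)
        ≤⟨ +-mono-≤ link-bound (go (S - v) (rec (x∈p⇒p-x⊂p v∈S))) ⟩
      d ^ k + d ^ k * ∣ S - v ∣
        ≡⟨ *-suc (d ^ k) ∣ S - v ∣ ⟨
      d ^ k * suc ∣ S - v ∣
        ≤⟨ *-monoʳ-≤ (d ^ k) (x∈p⇒∣p-x∣<∣p∣ v∈S) ⟩
      d ^ k * ∣ S ∣
        ∎
      where
      open ≤-Reasoning
      v∈S : v ∈ S
      v∈S = lookup⇒[]= v S S[v]≡true
      link⊆N : All (_⊆ neighboursIn H S v) (link v (within S E))
      link⊆N = All-link λ f∈ v∈f u∈f-v →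
        let f∈E , f⊆S = ∈-filter⁻ (_⊆? S) {xs = E} f∈
            u∈f = p─q⊆p _ ⁅ v ⁆ u∈f-v
        in ∈-neighboursIn H (f⊆S u∈f) (x∈p-y⇒x≢y u∈f-v) f∈E u∈f v∈f
      link-bound : length (link v (within S E)) ≤ d ^ k
      link-bound = ≤-trans
        (length≤∣T∣^m (link-unique (Unique.filter⁺ (_⊆? S) (simple H)))
                      (link-size (All.filter⁺ (_⊆? S) (uniform H))) link⊆N)
        (^-monoˡ-≤ k deg)

lemma4p4 : (n k : ℕ) → 1 ≤ k → (H : Hypergraph n k) → (d : ℕ) →
    IsSkeletalDegeneracy H d → e H ≤ d ^ (k ∸ 1) * n
lemma4p4 n (suc k) (s≤s z≤n) H d (degenerate , _) = begin
  e H                          ≡⟨ cong length (within-all (All.universal ⊆-max (edges H))) ⟨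
  length (within ⊤ (edges H))  ≤⟨ length-within-edges≤ H degenerate ⊤ ⟩
  d ^ k * ∣ ⊤ {n} ∣            ≡⟨ cong (d ^ k *_) (∣⊤∣≡n n) ⟩
  d ^ k * n                    ∎
  where open ≤-Reasoning
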